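{- Let $S$ be a twisted agreeable semigroup (with $D(s):=s*s$), let $a,b\in S$ satisfy $a\not\le b$, and let $F$ be a filter of $D(S)$. Then the following are equivalent: (1) $F$ is maximally $(a,b)$-separating; (2) $F$ is maximal (under inclusion) among filters of $D(S)$ with respect to the property that $D(a)\in F$ but $a*b\notin F$.
   Context: A twisted agreeable semigroup is a semigroup $S$ with a binary operation $*$ satisfying, for all $s,t,u,v\in S$: $(s*s)s=s$; $s*t=t*s$; $(s*t)s=(s*t)t$; $((u*v)s)*t=(s*t)(u*v)$; $u(s*t)=(us*ut)u$. With $D(s):=s*s$ it is a restriction semigroup; $D(S)=\{D(s)\mid s\in S\}$ is ordered by $\mathsf e\le\mathsf f$ iff $\mathsf e=\mathsf e\mathsf f$, and $S$ by the natural order $s\le t$ iff $s=D(s)t$. A filter of $D(S)$ is a subset closed under multiplication and upward closed in $D(S)$. For $a\not\le b$, a filter $F$ is $(a,b)$-separating if $D(a)\in F$ and there is no $\mathsf e\in F$ with $\mathsf e a=\mathsf e b$; it is maximally $(a,b)$-separating if maximal under inclusion among $(a,b)$-separating filters. -}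

module Defs where

open import Level using (Level; _⊔_; suc; Lift)
open import Algebra.Core using (Op₂)
open import Algebra.Structures using (IsSemigroup)
open import Data.Product using (Σ; ∃; _×_; _,_)
open import Relation.Nullary using (¬_)
open import Relation.Unary using (Pred; _⊆_)
open import Relation.Binary.PropositionalEquality using (_≡_)

record TwistedAgreeableSemigroup (c : Level) : Set (suc c) where
  infixl 7 _·_
  infixl 6 _*_
  field
    Carrier     : Set c
    _·_         : Op₂ Carrier
    _*_         : Op₂ Carrier
    isSemigroup : IsSemigroup _≡_ _·_
    ax1 : ∀ s → (s * s) · s ≡ s
    ax2 : ∀ s t → s * t ≡ t * s
    ax3 : ∀ s t → (s * t) · s ≡ (s * t) · t
    ax4 : ∀ s t u v → ((u * v) · s) * t ≡ (s * t) · (u * v)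
    ax5 : ∀ s t u → u · (s * t) ≡ ((u · s) * (u · t)) · u

  D : Carrier → Carrier
  D s = s * s

  InD : Carrier → Set c
  InD x = ∃ λ s → x ≡ D s

  _≤D_ : Carrier → Carrier → Set c
  e ≤D f = e ≡ e · f

  _≤_ : Carrier → Carrier → Set c
  s ≤ t = s ≡ D s · t

  record IsFilter {ℓ : Level} (F : Pred Carrier ℓ) : Set (c ⊔ ℓ) where
    field
      sub    : F ⊆ InD
      mulCl  : ∀ {e f} → F e → F f → F (e · f)
      upCl   : ∀ {e f} → F e → InD f → e ≤D f → F f

  MaximalFilterWith : {ℓ : Level} → (Pred Carrier ℓ → Set (c ⊔ ℓ)) → Pred Carrier ℓ → Set (c ⊔ suc ℓ)
  MaximalFilterWith {ℓ} P F =
    P F × (∀ (G : Pred Carrier ℓ) → IsFilter G → P G → F ⊆ G → G ⊆ F)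

  Separating : {ℓ : Level} → Carrier → Carrier → Pred Carrier ℓ → Set (c ⊔ ℓ)
  Separating a b F = F (D a) × ¬ (∃ λ e → F e × (e · a ≡ e · b))

  MaximallySeparating : {ℓ : Level} → Carrier → Carrier → Pred Carrier ℓ → Set (c ⊔ suc ℓ)
  MaximallySeparating a b F = MaximalFilterWith (Separating a b) F

  ContainsDaNotStar : {ℓ : Level} → Carrier → Carrier → Pred Carrier ℓ → Set (c ⊔ ℓ)
  ContainsDaNotStar {ℓ} a b F = Lift c (F (D a) × ¬ F (a * b))

-- For a filter G containing D(a), some e ∈ G equalises a and b exactly when a * b ∈ G.
-- The projection a * b itself equalises a and b (axiom 3); conversely, if e a = e b then
-- f := e D(a) satisfies f a = f b, and axiom 5 gives f (a * b) = D(f a) f = f D(a) = f,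
-- so f ≤ a * b and a * b ∈ G by upward closure. Hence the two properties agree on
-- filters, and so do the maximal filters with them.
module Submission where

open import Defs
open import Level using (Level; _⊔_; lift)
open import Relation.Nullary using (¬_)
open import Relation.Unary using (Pred)
open import Function.Bundles using (_⇔_; mk⇔; Equivalence)
open import Data.Product using (_,_)
open import Algebra.Structures using (IsSemigroup)
open import Relation.Binary.PropositionalEquality

maximalFilterWith-cong : ∀ {c ℓ} (S : TwistedAgreeableSemigroup c) →
  let open TwistedAgreeableSemigroup S in
  {P Q : Pred Carrier ℓ → Set (c ⊔ ℓ)} →
  (∀ G → IsFilter G → P G ⇔ Q G) →
  ∀ {F} → IsFilter F → MaximalFilterWith P F ⇔ MaximalFilterWith Q F
maximalFilterWith-cong S P⇔Q {F} isF = mk⇔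
  (λ (PF , maxP) → to (P⇔Q F isF) PF , λ G isG QG F⊆G → maxP G isG (from (P⇔Q G isG) QG) F⊆G)
  (λ (QF , maxQ) → from (P⇔Q F isF) QF , λ G isG PG F⊆G → maxQ G isG (to (P⇔Q G isG) PG) F⊆G)
  where open Equivalence

module TwistedAgreeableProperties {c : Level} (S : TwistedAgreeableSemigroup c) where
  open TwistedAgreeableSemigroup S
  open ≡-Reasoning

  ·-assoc : ∀ x y z → (x · y) · z ≡ x · (y · z)
  ·-assoc = IsSemigroup.assoc isSemigroup

  D-idem : ∀ s → D s · D s ≡ D s
  D-idem s = sym (trans (cong (_* s) (sym (ax1 s))) (ax4 s s s s))

  D-D : ∀ s → D (D s) ≡ D s
  D-D s = begin
    D (D s)           ≡⟨ cong (_* D s) (sym (D-idem s)) ⟩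
    (D s · D s) * D s ≡⟨ ax4 (D s) (D s) s s ⟩
    D (D s) · D s     ≡⟨ ax1 (D s) ⟩
    D s               ∎

  ·-D-twist : ∀ x s → x · D s ≡ D (x · s) · x
  ·-D-twist x s = ax5 s s x

  *-·-D : ∀ u v → u * v ≡ (u * v) · D u
  *-·-D u v = trans (cong (_* v) (sym (ax1 u))) (ax4 u v u u)

  D-comm : ∀ p q → D p · D q ≡ D q · D p
  D-comm p q = begin
    D p · D q           ≡⟨ cong (D p ·_) (sym (D-D q)) ⟩
    D p · D (D q)       ≡⟨ ·-D-twist (D p) (D q) ⟩
    D (D p · D q) · D p ≡⟨ cong (_· D p) D[DpDq] ⟩
    (D q · D p) · D p   ≡⟨ ·-assoc _ _ _ ⟩
    D q · (D p · D p)   ≡⟨ cong (D q ·_) (D-idem p) ⟩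
    D q · D p           ∎
    where
    D[DpDq] : D (D p · D q) ≡ D q · D p
    D[DpDq] = begin
      D (D p · D q)             ≡⟨ ax4 (D q) (D p · D q) p p ⟩
      (D q * (D p · D q)) · D p ≡⟨ cong (_· D p) (ax2 (D q) (D p · D q)) ⟩
      ((D p · D q) * D q) · D p ≡⟨ cong (_· D p) (ax4 (D q) (D q) p p) ⟩
      (D (D q) · D p) · D p     ≡⟨ cong (λ z → (z · D p) · D p) (D-D q) ⟩
      (D q · D p) · D p         ≡⟨ ·-assoc _ _ _ ⟩
      D q · (D p · D p)         ≡⟨ cong (D q ·_) (D-idem p) ⟩
      D q · D p                 ∎

  D-·-* : ∀ u v → D u · (u * v) ≡ u * v
  D-·-* u v = begin
    D u · (u * v)                 ≡⟨ ax5 u v (D u) ⟩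
    ((D u · u) * (D u · v)) · D u ≡⟨ cong (λ z → (z * (D u · v)) · D u) (ax1 u) ⟩
    (u * (D u · v)) · D u         ≡⟨ cong (_· D u) (ax2 u (D u · v)) ⟩
    ((D u · v) * u) · D u         ≡⟨ cong (_· D u) (ax4 v u u u) ⟩
    ((v * u) · D u) · D u         ≡⟨ cong (λ z → (z · D u) · D u) (ax2 v u) ⟩
    ((u * v) · D u) · D u         ≡⟨ ·-assoc _ _ _ ⟩
    (u * v) · (D u · D u)         ≡⟨ cong ((u * v) ·_) (D-idem u) ⟩
    (u * v) · D u                 ≡⟨ sym (*-·-D u v) ⟩
    u * v                         ∎

  *-idem : ∀ u v → (u * v) · (u * v) ≡ u * v
  *-idem u v = begin
    E · E                   ≡⟨ ax5 u v E ⟩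
    ((E · u) * (E · v)) · E ≡⟨ cong (λ z → ((E · u) * z) · E) (sym (ax3 u v)) ⟩
    D (E · u) · E           ≡⟨ sym (·-D-twist E u) ⟩
    E · D u                 ≡⟨ sym (*-·-D u v) ⟩
    E                       ∎
    where
    E = u * v

  D-* : ∀ u v → D (u * v) ≡ u * v
  D-* u v = begin
    (u * v) * (u * v)                   ≡⟨ cong (_* (u * v)) (*-·-D u v) ⟩
    ((u * v) · D u) * (u * v)           ≡⟨ ax4 (D u) (u * v) u v ⟩
    (D u * (u * v)) · (u * v)           ≡⟨ cong (_· (u * v)) (ax2 (D u) (u * v)) ⟩
    ((u * v) * D u) · (u * v)           ≡⟨ cong (λ z → (z * D u) · (u * v)) (*-·-D u v) ⟩
    (((u * v) · D u) * D u) · (u * v)   ≡⟨ cong (_· (u * v)) (ax4 (D u) (D u) u v) ⟩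
    (D (D u) · (u * v)) · (u * v)       ≡⟨ cong (λ z → (z · (u * v)) · (u * v)) (D-D u) ⟩
    (D u · (u * v)) · (u * v)           ≡⟨ cong (_· (u * v)) (D-·-* u v) ⟩
    (u * v) · (u * v)                   ≡⟨ *-idem u v ⟩
    u * v                               ∎

  *-∈-D : ∀ u v → InD (u * v)
  *-∈-D u v = u * v , sym (D-* u v)

  ·-*-equaliser : ∀ {f a b} → f · a ≡ f · b → f · (a * b) ≡ f · D a
  ·-*-equaliser {f} {a} {b} fa≡fb = begin
    f · (a * b)             ≡⟨ ax5 a b f ⟩
    ((f · a) * (f · b)) · f ≡⟨ cong (λ z → ((f · a) * z) · f) (sym fa≡fb) ⟩
    D (f · a) · f           ≡⟨ sym (·-D-twist f a) ⟩
    f · D a                 ∎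

  equaliser-≤D-* : ∀ {e a b} → InD e → e · a ≡ e · b → (e · D a) ≤D (a * b)
  equaliser-≤D-* {e} {a} {b} (s , e≡Ds) ea≡eb = sym (begin
    f · (a * b)     ≡⟨ ·-*-equaliser fa≡fb ⟩
    f · D a         ≡⟨ ·-assoc e (D a) (D a) ⟩
    e · (D a · D a) ≡⟨ cong (e ·_) (D-idem a) ⟩
    f               ∎)
    where
    f = e · D a
    f≡Da·e : f ≡ D a · e
    f≡Da·e = begin
      e · D a   ≡⟨ cong (_· D a) e≡Ds ⟩
      D s · D a ≡⟨ D-comm s a ⟩
      D a · D s ≡⟨ cong (D a ·_) (sym e≡Ds) ⟩
      D a · e   ∎
    fa≡fb : f · a ≡ f · b
    fa≡fb = begin
      f · a         ≡⟨ cong (_· a) f≡Da·e ⟩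
      (D a · e) · a ≡⟨ ·-assoc _ _ _ ⟩
      D a · (e · a) ≡⟨ cong (D a ·_) ea≡eb ⟩
      D a · (e · b) ≡⟨ sym (·-assoc _ _ _) ⟩
      (D a · e) · b ≡⟨ cong (_· b) (sym f≡Da·e) ⟩
      f · b         ∎

  separating⇔containsDaNotStar : ∀ {ℓ} (a b : Carrier) (G : Pred Carrier ℓ) → IsFilter G →
    Separating a b G ⇔ ContainsDaNotStar a b G
  separating⇔containsDaNotStar a b G isG = mk⇔
    (λ (GDa , noEqualiser) → lift (GDa , λ Ga*b → noEqualiser (a * b , Ga*b , ax3 a b)))
    (λ (lift (GDa , a*b∉G)) → GDa , λ (e , Ge , ea≡eb) → a*b∉G (equaliser⇒* GDa Ge ea≡eb))
    where
    open IsFilter isG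
    equaliser⇒* : ∀ {e} → G (D a) → G e → e · a ≡ e · b → G (a * b)
    equaliser⇒* GDa Ge ea≡eb =
      upCl (mulCl Ge GDa) (*-∈-D a b) (equaliser-≤D-* (sub Ge) ea≡eb)

lemma2p16 : ∀ {c ℓ : Level} (S : TwistedAgreeableSemigroup c) →
    let open TwistedAgreeableSemigroup S in
    (a b : Carrier) → ¬ (a ≤ b) → (F : Pred Carrier ℓ) → IsFilter F →
    (MaximallySeparating a b F ⇔ MaximalFilterWith (ContainsDaNotStar a b) F)
lemma2p16 S a b _ F isF =
  maximalFilterWith-cong S (separating⇔containsDaNotStar a b) isF
  where open TwistedAgreeableProperties S
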